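{- Let $p>3$ be a prime, $t\in \{1,3,p,3p\}$, and $1\leqslant r\leqslant 3p-1$ with $\gcd(r,3p)=1$. Then \[\mathcal{S}(3,r,t)=\begin{cases} 3(|r|_p-1) & \text{if } r\equiv 1\pmod 3 \text{ and }t\in\{3,3p\},\\ 3(|r|_p-1) & \text{if } r\equiv 1\pmod 3,\ t\in\{1,p\} \text{ and } 3\nmid |r|_p, \\ |r|_p-3 & \text{if } r\equiv 1\pmod 3,\ t\in\{1,p\} \text{ and }3\mid |r|_p,\\ 3(|r|_p-1) & \text{if } r\equiv 2\pmod 3\text{ and $|r|_p$ is odd}, \\ 3\left(\frac{|r|_p}{2}-1\right) & \text{if } r\equiv 2\pmod 3\text{ and $|r|_p$ is even}. \end{cases}\]
   Context: $\phi$ is Euler's totient function; $|r|_m$ is the multiplicative order of $r$ modulo $m$. $S_k(x)=1+x+\cdots+x^{k-1}$ for $k\ge1$, $S_0(x)=0$; for a positive integer $m$ with $\gcd(r,m)=1$, $\kappa(m,r,t)=\dfrac{m|r|_m}{\gcd(m,\ tS_{|r|_m}(r))}$. For a divisor $d$ of $3p$, $\Lambda(d,r,t)=\{\ell>0\mid \ell \text{ divides } \frac{|r|_{3p}}{\gcd(\kappa(d,r,t),|r|_{3p})} \text{ and } \gcd(r^{\ell\kappa(d,r,t)}-1,3p)=d\}$ and $\mathcal{S}(d,r,t)=\sum_{\ell\in \Lambda(d,r,t)} d\,\phi\!\left(\frac{|r|_{3p}}{\ell \gcd(\kappa(d,r,t),|r|_{3p})}\right)$. -}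

module Defs where

open import Data.Nat using (ℕ; zero; suc; _+_; _*_; _∸_; _^_; _≟_)
open import Data.Nat.DivMod using (_/_; _%_)
open import Data.Nat.GCD using (gcd)
open import Data.Nat.Divisibility using (_∣?_)
open import Data.Bool using (Bool; if_then_else_; _∧_)
open import Relation.Nullary.Decidable using (⌊_⌋)

-- natural-number remainder / quotient, total (value for divisor 0 is irrelevant:
-- all divisors used below are positive)
modℕ : ℕ → ℕ → ℕ
modℕ a zero    = a
modℕ a (suc m) = a % suc m

divℕ : ℕ → ℕ → ℕ
divℕ a zero    = 0
divℕ a (suc m) = a / suc m

firstFrom : ℕ → ℕ → (ℕ → Bool) → ℕ
firstFrom zero    s P = 0
firstFrom (suc f) s P = if P s then s else firstFrom f (suc s) P

-- multiplicative order |r|_m : least k ≥ 1 with r^k ≡ 1 (mod m).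
-- For gcd(r,m)=1 and m ≥ 1 it lies in [1, m], so the bounded search is exact.
ord : ℕ → ℕ → ℕ
ord m r = firstFrom m 1 (λ k → ⌊ modℕ (r ^ k) m ≟ modℕ 1 m ⌋)

sumRange : ℕ → (ℕ → ℕ) → ℕ
sumRange zero    f = 0
sumRange (suc n) f = sumRange n f + f (suc n)

φ : ℕ → ℕ
φ n = sumRange n (λ k → if ⌊ gcd k n ≟ 1 ⌋ then 1 else 0)

Sgeom : ℕ → ℕ → ℕ
Sgeom zero    x = 0
Sgeom (suc k) x = Sgeom k x + x ^ k

κ : ℕ → ℕ → ℕ → ℕ
κ m r t = divℕ (m * ord m r) (gcd m (t * Sgeom (ord m r) r))

-- 𝒮(d,r,t) for the modulus 3p (p passed explicitly):
-- sum over ℓ ∈ Λ(d,r,t) of d φ(|r|_{3p} / (ℓ gcd(κ(d,r,t), |r|_{3p}))),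
-- where Λ(d,r,t) = { ℓ > 0 : ℓ ∣ N, gcd(r^(ℓ κ) - 1, 3p) = d },
-- N = |r|_{3p} / gcd(κ, |r|_{3p}). Since N ≥ 1 in all relevant cases,
-- every such ℓ lies in [1, N].
𝒮 : ℕ → ℕ → ℕ → ℕ → ℕ
𝒮 p d r t =
  let n   = 3 * p
      o   = ord n r
      k   = κ d r t
      g   = gcd k o
      N   = divℕ o g
  in sumRange N (λ ℓ →
       if ⌊ ℓ ∣? N ⌋ ∧ ⌊ gcd (r ^ (ℓ * k) ∸ 1) n ≟ d ⌋
       then d * φ (divℕ o (ℓ * g))
       else 0)

{-# OPTIONS --safe #-}
-- Write o = |r|_{3p}, κ = κ(3,r,t) and N = o / gcd(κ, o). Since |r|_3 divides κ, the prime 3 always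
-- divides r^(ℓκ) - 1, while p divides it iff |r|_p ∣ ℓκ iff o ∣ ℓκ iff N ∣ ℓ. So among the divisors ℓ of N
-- the condition defining Λ(3,r,t) singles out exactly those with ℓ < N, and Gauss's identity
-- Σ_{ℓ ∣ N} φ(N/ℓ) = N gives 𝒮(3,r,t) = 3(N - 1). The same divisibility description shows that
-- N = |r|_p / gcd(κ, |r|_p), and the five cases are κ = 1, 3, 3, 2, 2 with gcd(κ, |r|_p) = 1, 1, 3, 1, 2.
module Submission where

open import Defs
open import Data.Bool using (Bool; true; false; T; if_then_else_; _∧_)
open import Data.Bool.Properties using (if-float)
open import Data.Fin using (toℕ; fromℕ<)
open import Data.Fin.Properties using (pigeonhole; toℕ<n; toℕ-fromℕ<)
open import Data.Nat
open import Data.Nat.Properties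
open import Algebra.Properties.CommutativeSemigroup +-commutativeSemigroup
  using () renaming (interchange to +-interchange)
open import Data.Nat.DivMod
open import Data.Nat.Divisibility
open import Data.Nat.GCD
open import Data.Nat.Coprimality using (Coprime; coprime-divisor; coprime-/gcd; coprime⇒gcd≡1; prime⇒coprime; 1-coprimeTo)
  renaming (sym to coprime-sym)
open import Data.Nat.Primality using (Prime; prime?; prime⇒irreducible; prime⇒nonZero; prime⇒nonTrivial; prime[2])
open import Data.Product using (_×_; _,_; ∃; proj₁; proj₂)
open import Data.Product.Function.NonDependent.Propositional using (_×-⇔_)
open import Data.Sum using (_⊎_; inj₁; inj₂; [_,_]′; fromInj₂)
open import Data.Unit using (tt)
open import Function.Base using (_∘_)
open import Function.Bundles using (_⇔_; mk⇔; Equivalence)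
open import Function.Properties.Equivalence using () renaming (sym to ⇔-sym; trans to ⇔-trans)
open import Relation.Nullary using (¬_; Dec; yes; no; contradiction)
open import Relation.Nullary.Decidable using (⌊_⌋; isYes≗does; dec-true; dec-false; does-⇔; toWitness; fromWitness; from-yes)
open import Relation.Binary.PropositionalEquality
open ≡-Reasoning

open Equivalence using (to; from)

⌊⌋-true : ∀ {a} {A : Set a} (a? : Dec A) → A → ⌊ a? ⌋ ≡ true
⌊⌋-true a? x = trans (isYes≗does a?) (dec-true a? x)

⌊⌋-false : ∀ {a} {A : Set a} (a? : Dec A) → ¬ A → ⌊ a? ⌋ ≡ false
⌊⌋-false a? ¬x = trans (isYes≗does a?) (dec-false a? ¬x)

⌊⌋-⇔ : ∀ {a b} {A : Set a} {B : Set b} → A ⇔ B → (a? : Dec A) (b? : Dec B) → ⌊ a? ⌋ ≡ ⌊ b? ⌋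
⌊⌋-⇔ A⇔B a? b? = trans (isYes≗does a?) (trans (does-⇔ A⇔B a? b?) (sym (isYes≗does b?)))

divℕ≡/ : ∀ a m .{{_ : NonZero m}} → divℕ a m ≡ a / m
divℕ≡/ a (suc m) = refl

modℕ≡% : ∀ a m .{{_ : NonZero m}} → modℕ a m ≡ a % m
modℕ≡% a (suc m) = refl

divℕ-*-divℕ : ∀ a m n .{{_ : NonZero m}} .{{_ : NonZero n}} → divℕ a (n * m) ≡ divℕ (divℕ a m) n
divℕ-*-divℕ a (suc m) (suc n) = trans (/-congʳ {m = a} (*-comm (suc n) (suc m))) (sym (m/n/o≡m/[n*o] a (suc m) (suc n)))

*-≡ˡ⇔≡1 : ∀ d x .{{_ : NonZero d}} → d * x ≡ d ⇔ x ≡ 1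
*-≡ˡ⇔≡1 d x = mk⇔ (λ dx≡d → *-cancelˡ-≡ x 1 d (trans dx≡d (sym (*-identityʳ d))))
                  (λ x≡1 → trans (cong (d *_) x≡1) (*-identityʳ d))

∣-ext : ∀ {a b} → (∀ n → a ∣ n ⇔ b ∣ n) → a ≡ b
∣-ext a⇔b = ∣-antisym (from (a⇔b _) ∣-refl) (to (a⇔b _) ∣-refl)

∣⇒gcd≡ : ∀ {d n} → d ∣ n → gcd d n ≡ d
∣⇒gcd≡ {d} {n} d∣n = ∣-antisym (gcd[m,n]∣m d n) (gcd-greatest ∣-refl d∣n)

prime∤⇒gcd≡1 : ∀ {q n} → Prime q → ¬ q ∣ n → gcd q n ≡ 1
prime∤⇒gcd≡1 {q} {n} q-prime q∤n with prime⇒irreducible q-prime (gcd[m,n]∣m q n)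
... | inj₁ gcd≡1 = gcd≡1
... | inj₂ gcd≡q = contradiction (subst (_∣ n) gcd≡q (gcd[m,n]∣n q n)) q∤n

prime[3] : Prime 3
prime[3] = from-yes (prime? 3)

coprime-*∣⇔ : ∀ {a b x} → Coprime a b → a * b ∣ x ⇔ (a ∣ x × b ∣ x)
coprime-*∣⇔ {a} {b} a⊥b = mk⇔ (λ ab∣x → m*n∣⇒m∣ a b ab∣x , m*n∣⇒n∣ a b ab∣x) from′
  where
  from′ : ∀ {x} → a ∣ x × b ∣ x → a * b ∣ x
  from′ (divides-refl q , b∣qa) = subst (_∣ q * a) (*-comm b a)
    (*-monoˡ-∣ a (coprime-divisor (coprime-sym a⊥b) (subst (b ∣_) (*-comm q a) b∣qa)))

coprime-*ʳ⇒coprime : ∀ {r a} b → Coprime r (a * b) → Coprime r a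
coprime-*ʳ⇒coprime b r⊥ab (d∣r , d∣a) = r⊥ab (d∣r , ∣m⇒∣m*n b d∣a)

coprime-divisor-^ : ∀ {m r} a {x} → Coprime m r → m ∣ r ^ a * x → m ∣ x
coprime-divisor-^ {m} {r} zero    {x} m⊥r m∣x = subst (m ∣_) (*-identityˡ x) m∣x
coprime-divisor-^ {m} {r} (suc a) {x} m⊥r m∣rrᵃx =
  coprime-divisor-^ a m⊥r (coprime-divisor m⊥r (subst (m ∣_) (*-assoc r (r ^ a) x) m∣rrᵃx))

-- With g = gcd k o, o = (o/g) g and k = (k/g) g where o/g and k/g are coprime.
∣*⇔/gcd∣ : ∀ o k ℓ .{{_ : NonZero o}} → o ∣ ℓ * k ⇔ divℕ o (gcd k o) ∣ ℓ
∣*⇔/gcd∣ o k ℓ = mk⇔ to′ from′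
  where
  g : ℕ
  g = gcd k o
  instance
    g≢0 : NonZero g
    g≢0 = ≢-nonZero (gcd[m,n]≢0 k o (inj₂ (≢-nonZero⁻¹ o)))
  o≡Ng : o ≡ o / g * g
  o≡Ng = sym (m/n*n≡m (gcd[m,n]∣n k o))
  ℓk≡ℓKg : ℓ * k ≡ ℓ * (k / g) * g
  ℓk≡ℓKg = trans (cong (ℓ *_) (sym (m/n*n≡m (gcd[m,n]∣m k o)))) (sym (*-assoc ℓ (k / g) g))
  to′ : o ∣ ℓ * k → divℕ o g ∣ ℓ
  to′ o∣ℓk = subst (_∣ ℓ) (sym (divℕ≡/ o g))
    (coprime-divisor (coprime-sym (coprime-/gcd k o))
      (subst (o / g ∣_) (*-comm ℓ (k / g)) (*-cancelʳ-∣ g (subst₂ _∣_ o≡Ng ℓk≡ℓKg o∣ℓk))))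
  from′ : divℕ o g ∣ ℓ → o ∣ ℓ * k
  from′ N∣ℓ = subst (_∣ ℓ * k) (sym o≡Ng)
    (∣-trans (*-monoˡ-∣ g (subst (_∣ ℓ) (divℕ≡/ o g) N∣ℓ)) (*-monoʳ-∣ ℓ (gcd[m,n]∣m k o)))

gcd-*≡⇔ : ∀ {p q} x .{{_ : NonZero q}} → Prime p → Coprime q p → gcd x (q * p) ≡ q ⇔ (q ∣ x × ¬ p ∣ x)
gcd-*≡⇔ {p} {q} x p-prime q⊥p = mk⇔ to′ from′
  where
  to′ : gcd x (q * p) ≡ q → q ∣ x × ¬ p ∣ x
  to′ gcd≡q = q∣x , λ p∣x → nonTrivial⇒≢1 {{prime⇒nonTrivial p-prime}} (∣1⇒≡1 (*-cancelˡ-∣ q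
      (subst (q * p ∣_) (trans gcd≡q (sym (*-identityʳ q)))
        (gcd-greatest (from (coprime-*∣⇔ q⊥p) (q∣x , p∣x)) ∣-refl))))
    where
    q∣x : q ∣ x
    q∣x = subst (_∣ x) gcd≡q (gcd[m,n]∣m x (q * p))
  from′ : q ∣ x × ¬ p ∣ x → gcd x (q * p) ≡ q
  from′ (q∣x , p∤x) with gcd-greatest q∣x (m∣m*n {q} p)
  ... | divides e gcd≡eq with prime⇒irreducible p-prime
                               (*-cancelˡ-∣ q (subst (_∣ q * p) (trans gcd≡eq (*-comm e q)) (gcd[m,n]∣n x (q * p))))
  ...   | inj₁ refl = trans gcd≡eq (*-identityˡ q)
  ...   | inj₂ refl = contradiction (∣-trans (subst (p ∣_) (sym gcd≡eq) (m∣m*n q)) (gcd[m,n]∣m x (q * p))) p∤x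

sumRange-cong : ∀ n {f g : ℕ → ℕ} → (∀ i → 1 ≤ i → i ≤ n → f i ≡ g i) →
                sumRange n f ≡ sumRange n g
sumRange-cong zero    f≗g = refl
sumRange-cong (suc n) f≗g =
  cong₂ _+_ (sumRange-cong n (λ i 1≤i i≤n → f≗g i 1≤i (m≤n⇒m≤1+n i≤n))) (f≗g (suc n) (s≤s z≤n) ≤-refl)

sumRange-const : ∀ n c → sumRange n (λ _ → c) ≡ n * c
sumRange-const zero    c = refl
sumRange-const (suc n) c = trans (cong (_+ c) (sumRange-const n c)) (+-comm (n * c) c)

sumRange-zero : ∀ n {f : ℕ → ℕ} → (∀ i → 1 ≤ i → i ≤ n → f i ≡ 0) → sumRange n f ≡ 0
sumRange-zero n f≗0 = trans (sumRange-cong n f≗0) (trans (sumRange-const n 0) (*-zeroʳ n))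

sumRange-single : ∀ n {f : ℕ → ℕ} c → 1 ≤ c → c ≤ n →
                  (∀ i → 1 ≤ i → i ≤ n → i ≢ c → f i ≡ 0) → sumRange n f ≡ f c
sumRange-single zero    (suc _) _   ()    _
sumRange-single (suc n) {f} c 1≤c c≤1+n f≗0 with c ≟ suc n
... | yes refl = cong (_+ f (suc n))
  (sumRange-zero n (λ i 1≤i i≤n → f≗0 i 1≤i (m≤n⇒m≤1+n i≤n) (<⇒≢ (s≤s i≤n))))
... | no c≢1+n = begin
  sumRange n f + f (suc n) ≡⟨ cong₂ _+_ (sumRange-single n c 1≤c (≤-pred (≤∧≢⇒< c≤1+n c≢1+n))
                                           (λ i 1≤i i≤n → f≗0 i 1≤i (m≤n⇒m≤1+n i≤n)))
                                        (f≗0 (suc n) (s≤s z≤n) ≤-refl (≢-sym c≢1+n)) ⟩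
  f c + 0                  ≡⟨ +-identityʳ (f c) ⟩
  f c                      ∎

sumRange-+ : ∀ n (f g : ℕ → ℕ) → sumRange n (λ i → f i + g i) ≡ sumRange n f + sumRange n g
sumRange-+ zero    f g = refl
sumRange-+ (suc n) f g = trans (cong (_+ (f (suc n) + g (suc n))) (sumRange-+ n f g))
                               (+-interchange (sumRange n f) (sumRange n g) (f (suc n)) (g (suc n)))

sumRange-* : ∀ n c (f : ℕ → ℕ) → sumRange n (λ i → c * f i) ≡ c * sumRange n f
sumRange-* zero    c f = sym (*-zeroʳ c)
sumRange-* (suc n) c f =
  trans (cong (_+ c * f (suc n)) (sumRange-* n c f)) (sym (*-distribˡ-+ c (sumRange n f) (f (suc n))))

sumRange-swap : ∀ m n (f : ℕ → ℕ → ℕ) →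
                sumRange m (λ i → sumRange n (f i)) ≡ sumRange n (λ j → sumRange m (λ i → f i j))
sumRange-swap zero    n f = sym (sumRange-zero n (λ _ _ _ → refl))
sumRange-swap (suc m) n f = trans (cong (_+ sumRange n (f (suc m))) (sumRange-swap m n f))
                                  (sym (sumRange-+ n (λ j → sumRange m (λ i → f i j)) (f (suc m))))

sumRange-split : ∀ m n (f : ℕ → ℕ) → sumRange (m + n) f ≡ sumRange m f + sumRange n (λ i → f (m + i))
sumRange-split m zero    f = trans (cong (λ k → sumRange k f) (+-identityʳ m)) (sym (+-identityʳ _))
sumRange-split m (suc n) f = begin
  sumRange (m + suc n) f                                       ≡⟨ cong (λ k → sumRange k f) (+-suc m n) ⟩
  sumRange (m + n) f + f (suc (m + n))                         ≡⟨ cong₂ _+_ (sumRange-split m n f) (cong f (sym (+-suc m n))) ⟩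
  (sumRange m f + sumRange n (λ i → f (m + i))) + f (m + suc n) ≡⟨ +-assoc (sumRange m f) _ _ ⟩
  sumRange m f + sumRange (suc n) (λ i → f (m + i))            ∎

-- Only the multiples of d contribute, one in each block of d consecutive terms.
sumRange-multiples : ∀ d q .{{_ : NonZero d}} (f : ℕ → ℕ) → (∀ i → ¬ d ∣ i → f i ≡ 0) →
                     sumRange (d * q) f ≡ sumRange q (λ j → f (d * j))
sumRange-multiples d zero    f f≗0 = cong (λ k → sumRange k f) (*-zeroʳ d)
sumRange-multiples d (suc q) f f≗0 = begin
  sumRange (d * suc q) f                                ≡⟨ cong (λ k → sumRange k f) (trans (*-suc d q) (+-comm d (d * q))) ⟩
  sumRange (d * q + d) f                                ≡⟨ sumRange-split (d * q) d f ⟩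
  sumRange (d * q) f + sumRange d (λ i → f (d * q + i)) ≡⟨ cong₂ _+_ (sumRange-multiples d q f f≗0) lastBlock ⟩
  sumRange q (λ j → f (d * j)) + f (d * suc q)          ∎
  where
  lastBlock : sumRange d (λ i → f (d * q + i)) ≡ f (d * suc q)
  lastBlock = trans (sumRange-single d d (>-nonZero⁻¹ d) ≤-refl inner)
                    (cong f (trans (+-comm (d * q) d) (sym (*-suc d q))))
    where
    inner : ∀ i → 1 ≤ i → i ≤ d → i ≢ d → f (d * q + i) ≡ 0
    inner i 1≤i i≤d i≢d = f≗0 _ (λ d∣dq+i → i≢d (≤-antisym i≤d
      (∣⇒≤ {{>-nonZero 1≤i}} (∣m+n∣m⇒∣n d∣dq+i (m∣m*n q)))))

-- The k ≤ N with gcd k N = d are the d j with j ≤ N / d and gcd j (N / d) = 1.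
sumRange-gcd≡ : ∀ N d .{{_ : NonZero d}} →
             sumRange N (λ k → if ⌊ gcd k N ≟ d ⌋ then 1 else 0) ≡ (if ⌊ d ∣? N ⌋ then φ (divℕ N d) else 0)
sumRange-gcd≡ N d with d ∣? N
... | no d∤N = sumRange-zero N λ k _ _ →
  cong (λ b → if b then 1 else 0) (⌊⌋-false (gcd k N ≟ d) λ gcd≡d → d∤N (subst (_∣ N) gcd≡d (gcd[m,n]∣n k N)))
... | yes (divides-refl q) = begin
  sumRange (q * d) indicator          ≡⟨ cong (λ n → sumRange n indicator) (*-comm q d) ⟩
  sumRange (d * q) indicator          ≡⟨ sumRange-multiples d q indicator off-multiples ⟩
  sumRange q (λ j → indicator (d * j)) ≡⟨ sumRange-cong q (λ j _ _ → cong (λ b → if b then 1 else 0) (at-multiple j)) ⟩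
  φ q                                 ≡⟨ cong φ (trans (divℕ≡/ (q * d) d) (m*n/n≡m q d)) ⟨
  φ (divℕ (q * d) d)                  ∎
  where
  indicator : ℕ → ℕ
  indicator k = if ⌊ gcd k (q * d) ≟ d ⌋ then 1 else 0
  off-multiples : ∀ k → ¬ d ∣ k → indicator k ≡ 0
  off-multiples k d∤k = cong (λ b → if b then 1 else 0)
    (⌊⌋-false (gcd k (q * d) ≟ d) λ gcd≡d → d∤k (subst (_∣ k) gcd≡d (gcd[m,n]∣m k (q * d))))
  gcd-scaled : ∀ j → gcd (d * j) (q * d) ≡ d * gcd j q
  gcd-scaled j = trans (cong (gcd (d * j)) (*-comm q d)) (sym (c*gcd[m,n]≡gcd[cm,cn] d j q))
  at-multiple : ∀ j → ⌊ gcd (d * j) (q * d) ≟ d ⌋ ≡ ⌊ gcd j q ≟ 1 ⌋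
  at-multiple j = ⌊⌋-⇔ (⇔-trans (mk⇔ (trans (sym (gcd-scaled j))) (trans (gcd-scaled j))) (*-≡ˡ⇔≡1 d (gcd j q)))
                       (gcd (d * j) (q * d) ≟ d) (gcd j q ≟ 1)

-- Gauss's identity: classify the k ≤ N by gcd k N.
sumRange-divisors-φ : ∀ N → sumRange N (λ d → if ⌊ d ∣? N ⌋ then φ (divℕ N d) else 0) ≡ N
sumRange-divisors-φ N = begin
  sumRange N (λ d → if ⌊ d ∣? N ⌋ then φ (divℕ N d) else 0)
    ≡⟨ sumRange-cong N (λ d 1≤d _ → sumRange-gcd≡ N d {{>-nonZero 1≤d}}) ⟨
  sumRange N (λ d → sumRange N (λ k → if ⌊ gcd k N ≟ d ⌋ then 1 else 0))
    ≡⟨ sumRange-swap N N (λ d k → if ⌊ gcd k N ≟ d ⌋ then 1 else 0) ⟩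
  sumRange N (λ k → sumRange N (λ d → if ⌊ gcd k N ≟ d ⌋ then 1 else 0))
    ≡⟨ sumRange-cong N one-gcd ⟩
  sumRange N (λ _ → 1)
    ≡⟨ trans (sumRange-const N 1) (*-identityʳ N) ⟩
  N ∎
  where
  one-gcd : ∀ k → 1 ≤ k → k ≤ N → sumRange N (λ d → if ⌊ gcd k N ≟ d ⌋ then 1 else 0) ≡ 1
  one-gcd k 1≤k k≤N = trans
    (sumRange-single N (gcd k N) (n≢0⇒n>0 (gcd[m,n]≢0 k N (inj₁ (≢-nonZero⁻¹ k {{>-nonZero 1≤k}}))))
       (gcd[m,n]≤n k N {{>-nonZero (≤-trans 1≤k k≤N)}})
       (λ d _ _ d≢gcd → cong (λ b → if b then 1 else 0) (⌊⌋-false (gcd k N ≟ d) (d≢gcd ∘ sym))))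
    (cong (λ b → if b then 1 else 0) (⌊⌋-true (gcd k N ≟ gcd k N) refl))

sumRange-properDivisors-φ : ∀ N .{{_ : NonZero N}} (c : ℕ → Bool) →
  ¬ T (c N) → (∀ ℓ → ℓ ∣ N → ℓ < N → T (c ℓ)) →
  sumRange N (λ ℓ → if ⌊ ℓ ∣? N ⌋ ∧ c ℓ then φ (divℕ N ℓ) else 0) ≡ N ∸ 1
sumRange-properDivisors-φ (suc n) c ¬c[N] c[proper] = begin
  sumRange n F + F (suc n) ≡⟨ cong₂ _+_ (sumRange-cong n (λ ℓ _ ℓ≤n → proper-term ℓ (s≤s ℓ≤n)))
                                        (last-term ¬c[N]) ⟩
  sumRange n G + 0         ≡⟨ +-identityʳ (sumRange n G) ⟩
  sumRange n G             ≡⟨ suc-injective (begin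
    1 + sumRange n G          ≡⟨ +-comm 1 (sumRange n G) ⟩
    sumRange n G + 1          ≡⟨ cong (sumRange n G +_) top-term ⟨
    sumRange n G + G (suc n)  ≡⟨ sumRange-divisors-φ (suc n) ⟩
    suc n                     ∎) ⟩
  n                        ∎
  where
  F G : ℕ → ℕ
  F ℓ = if ⌊ ℓ ∣? suc n ⌋ ∧ c ℓ then φ (divℕ (suc n) ℓ) else 0
  G ℓ = if ⌊ ℓ ∣? suc n ⌋ then φ (divℕ (suc n) ℓ) else 0
  proper-term : ∀ ℓ → ℓ < suc n → F ℓ ≡ G ℓ
  proper-term ℓ ℓ<N with ℓ ∣? suc n
  ... | no _ = refl
  ... | yes ℓ∣N with c ℓ | c[proper] ℓ ℓ∣N ℓ<N
  ...   | true | _ = refl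
  top-term : G (suc n) ≡ 1
  top-term = trans (cong (λ b → if b then φ (divℕ (suc n) (suc n)) else 0) (⌊⌋-true (suc n ∣? suc n) ∣-refl))
                   (cong φ (n/n≡1 (suc n)))
  last-term : ¬ T (c (suc n)) → F (suc n) ≡ 0
  last-term ¬c[N] with suc n ∣? suc n | c (suc n)
  ... | no _  | _     = refl
  ... | yes _ | false = refl
  ... | yes _ | true  = contradiction _ ¬c[N]

firstFrom-least : ∀ f s (P : ℕ → Bool) k → s ≤ k → k < s + f → T (P k) →
                  s ≤ firstFrom f s P × T (P (firstFrom f s P)) ×
                  (∀ j → s ≤ j → j < firstFrom f s P → ¬ T (P j))
firstFrom-least zero    s P k s≤k k<s+0 _ = contradiction (subst (k <_) (+-identityʳ s) k<s+0) (≤⇒≯ s≤k)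
firstFrom-least (suc f) s P k s≤k k<s+1+f Pk with P s in Ps
... | true  = ≤-refl , subst T (sym Ps) tt , λ j s≤j j<s → contradiction j<s (≤⇒≯ s≤j)
... | false with firstFrom-least f (suc s) P k s<k (subst (k <_) (+-suc s f) k<s+1+f) Pk
  where
  s<k : s < k
  s<k = ≤∧≢⇒< s≤k λ { refl → subst T Ps Pk }
...   | s<v , Pv , least = <⇒≤ s<v , Pv , least′
  where
  least′ : ∀ j → s ≤ j → j < firstFrom f (suc s) P → ¬ T (P j)
  least′ j s≤j j<v with s ≟ j
  ... | yes refl = subst T Ps
  ... | no s≢j   = least j (≤∧≢⇒< s≤j s≢j) j<v

%≡%⇔∣∸ : ∀ {x y} m .{{_ : NonZero m}} → y ≤ x → x % m ≡ y % m ⇔ m ∣ x ∸ y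
%≡%⇔∣∸ {x} {y} m y≤x = mk⇔ to′ from′
  where
  to′ : x % m ≡ y % m → m ∣ x ∸ y
  to′ x≡y = divides (x / m ∸ y / m) (begin
    x ∸ y                                  ≡⟨ cong₂ _∸_ (m≡m%n+[m/n]*n x m) (m≡m%n+[m/n]*n y m) ⟩
    (x % m + x / m * m) ∸ (y % m + y / m * m) ≡⟨ cong (λ z → (z + x / m * m) ∸ (y % m + y / m * m)) x≡y ⟩
    (y % m + x / m * m) ∸ (y % m + y / m * m) ≡⟨ [m+n]∸[m+o]≡n∸o (y % m) _ _ ⟩
    x / m * m ∸ y / m * m                  ≡⟨ *-distribʳ-∸ m (x / m) (y / m) ⟨
    (x / m ∸ y / m) * m                    ∎)
  from′ : m ∣ x ∸ y → x % m ≡ y % m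
  from′ m∣x∸y = trans (cong (_% m) (sym (m+[n∸m]≡n y≤x))) (%-remove-+ʳ y m∣x∸y)

%≡1%-*ʳ : ∀ a {b} m .{{_ : NonZero m}} → b % m ≡ 1 % m → (a * b) % m ≡ a % m
%≡1%-*ʳ a {b} m b≡1 = begin
  (a * b) % m             ≡⟨ %-distribˡ-* a b m ⟩
  (a % m * (b % m)) % m   ≡⟨ cong (λ z → (a % m * z) % m) b≡1 ⟩
  (a % m * (1 % m)) % m   ≡⟨ %-distribˡ-* a 1 m ⟨
  (a * 1) % m             ≡⟨ cong (_% m) (*-identityʳ a) ⟩
  a % m                   ∎

%≡1%-^ : ∀ {a} q m .{{_ : NonZero m}} → a % m ≡ 1 % m → a ^ q % m ≡ 1 % m
%≡1%-^ zero    m a≡1 = refl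
%≡1%-^ {a} (suc q) m a≡1 = begin
  (a * a ^ q) % m ≡⟨ cong (_% m) (*-comm a (a ^ q)) ⟩
  (a ^ q * a) % m ≡⟨ %≡1%-*ʳ (a ^ q) m a≡1 ⟩
  a ^ q % m       ≡⟨ %≡1%-^ q m a≡1 ⟩
  1 % m           ∎

module _ (m r : ℕ) .{{_ : NonZero m}} .{{_ : NonZero r}} (r⊥m : Coprime r m) where

  private
    m⊥r : Coprime m r
    m⊥r = coprime-sym r⊥m

  -- Two of the m + 1 residues r ^ 0, ..., r ^ m coincide.
  ord-exists : ∃ λ k → 1 ≤ k × k ≤ m × r ^ k % m ≡ 1 % m
  ord-exists with pigeonhole (n<1+n m) (λ i → fromℕ< (m%n<n (r ^ toℕ i) m))
  ... | i , j , i<j , residues≡ = k , m<n⇒0<n∸m i<j , k≤m , rᵏ≡1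
    where
    a k : ℕ
    a = toℕ i
    k = toℕ j ∸ a
    k≤m : k ≤ m
    k≤m = ≤-trans (m∸n≤m (toℕ j) a) (≤-pred (toℕ<n j))
    rʲ≡rᵃ : r ^ toℕ j % m ≡ r ^ a % m
    rʲ≡rᵃ = trans (sym (toℕ-fromℕ< (m%n<n (r ^ toℕ j) m)))
                  (trans (cong toℕ (sym residues≡)) (toℕ-fromℕ< (m%n<n (r ^ a) m)))
    rʲ≡rᵃrᵏ : r ^ toℕ j ≡ r ^ a * r ^ k
    rʲ≡rᵃrᵏ = trans (cong (r ^_) (sym (m+[n∸m]≡n (<⇒≤ i<j)))) (^-distribˡ-+-* r a k)
    rᵃ≤rʲ : r ^ a ≤ r ^ toℕ j
    rᵃ≤rʲ = ^-monoʳ-≤ r (<⇒≤ i<j)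
    m∣rᵃ[rᵏ∸1] : m ∣ r ^ a * (r ^ k ∸ 1)
    m∣rᵃ[rᵏ∸1] = subst (m ∣_) (begin
      r ^ toℕ j ∸ r ^ a           ≡⟨ cong₂ _∸_ rʲ≡rᵃrᵏ (sym (*-identityʳ (r ^ a))) ⟩
      r ^ a * r ^ k ∸ r ^ a * 1   ≡⟨ *-distribˡ-∸ (r ^ a) (r ^ k) 1 ⟨
      r ^ a * (r ^ k ∸ 1)         ∎) (to (%≡%⇔∣∸ m rᵃ≤rʲ) rʲ≡rᵃ)
    rᵏ≡1 : r ^ k % m ≡ 1 % m
    rᵏ≡1 = from (%≡%⇔∣∸ m (m^n>0 r k)) (coprime-divisor-^ a m⊥r m∣rᵃ[rᵏ∸1])

  private
    P : ℕ → Bool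
    P k = ⌊ modℕ (r ^ k) m ≟ modℕ 1 m ⌋

    T-P⇔ : ∀ k → T (P k) ⇔ r ^ k % m ≡ 1 % m
    T-P⇔ k = mk⇔ (λ t → trans (sym (modℕ≡% (r ^ k) m)) (trans (toWitness t) (modℕ≡% 1 m)))
                 (λ e → fromWitness (trans (modℕ≡% (r ^ k) m) (trans e (sym (modℕ≡% 1 m)))))

  ord-least : 1 ≤ ord m r × r ^ ord m r % m ≡ 1 % m ×
              (∀ j → 1 ≤ j → j < ord m r → r ^ j % m ≢ 1 % m)
  ord-least with ord-exists
  ... | k , 1≤k , k≤m , rᵏ≡1 with firstFrom-least m 1 P k 1≤k (s≤s k≤m) (from (T-P⇔ k) rᵏ≡1)
  ...   | 1≤o , P[o] , least =
    1≤o , to (T-P⇔ (ord m r)) P[o] , λ j 1≤j j<o rʲ≡1 → least j 1≤j j<o (from (T-P⇔ j) rʲ≡1)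

  ord-∣⇔ : ∀ n → ord m r ∣ n ⇔ m ∣ r ^ n ∸ 1
  ord-∣⇔ n = ⇔-trans (mk⇔ to′ from′) (%≡%⇔∣∸ m (m^n>0 r n))
    where
    o : ℕ
    o = ord m r
    instance
      o≢0 : NonZero o
      o≢0 = >-nonZero (proj₁ ord-least)
    shift : ∀ s q → r ^ (s + q * o) % m ≡ r ^ s % m
    shift s q = begin
      r ^ (s + q * o) % m        ≡⟨ cong (_% m) (^-distribˡ-+-* r s (q * o)) ⟩
      (r ^ s * r ^ (q * o)) % m  ≡⟨ %≡1%-*ʳ (r ^ s) m (subst (λ x → x % m ≡ 1 % m)
                                      (trans (^-*-assoc r o q) (cong (r ^_) (*-comm o q)))
                                      (%≡1%-^ q m (proj₁ (proj₂ ord-least)))) ⟩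
      r ^ s % m                  ∎
    to′ : o ∣ n → r ^ n % m ≡ 1 % m
    to′ (divides-refl q) = shift 0 q
    from′ : r ^ n % m ≡ 1 % m → o ∣ n
    from′ rⁿ≡1 with n % o ≟ 0
    ... | yes n%o≡0 = m%n≡0⇒n∣m n o n%o≡0
    ... | no  n%o≢0 = contradiction r^[n%o]≡1 (proj₂ (proj₂ ord-least) (n % o) (n≢0⇒n>0 n%o≢0) (m%n<n n o))
      where
      r^[n%o]≡1 : r ^ (n % o) % m ≡ 1 % m
      r^[n%o]≡1 = trans (sym (shift (n % o) (n / o))) (trans (cong (λ e → r ^ e % m) (sym (m≡m%n+[m/n]*n n o))) rⁿ≡1)

module _ {r : ℕ} .{{_ : NonZero r}} (r⊥3 : Coprime r 3) where

  private
    r¹%3≡r%3 : r ^ 1 % 3 ≡ r % 3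
    r¹%3≡r%3 = cong (_% 3) (*-identityʳ r)

    3∣rⁿ∸1 : ∀ n → r ^ n % 3 ≡ 1 → 3 ∣ r ^ n ∸ 1
    3∣rⁿ∸1 n = to (%≡%⇔∣∸ 3 (m^n>0 r n))

  r%3≡1⊎2 : r % 3 ≡ 1 ⊎ r % 3 ≡ 2
  r%3≡1⊎2 with r % 3 in r%3≡ | m%n<n r 3
  ... | 0 | _ = contradiction (r⊥3 (m%n≡0⇒n∣m r 3 r%3≡ , ∣-refl)) λ ()
  ... | 1 | _ = inj₁ refl
  ... | 2 | _ = inj₂ refl
  ... | suc (suc (suc _)) | s≤s (s≤s (s≤s ()))

  ord₃≡1 : r % 3 ≡ 1 → ord 3 r ≡ 1
  ord₃≡1 r≡1 = ∣1⇒≡1 (from (ord-∣⇔ 3 r r⊥3 1) (3∣rⁿ∸1 1 (trans r¹%3≡r%3 r≡1)))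

  ord₃≡2 : r % 3 ≡ 2 → ord 3 r ≡ 2
  ord₃≡2 r≡2 = fromInj₂ (λ ord≡1 → contradiction ord≡1 ord≢1)
                        (prime⇒irreducible prime[2] (from (ord-∣⇔ 3 r r⊥3 2) (3∣rⁿ∸1 2 r²≡1)))
    where
    r²≡1 : r ^ 2 % 3 ≡ 1
    r²≡1 = trans (%-distribˡ-* r (r * 1) 3) (cong₂ (λ a b → (a * b) % 3) r≡2 (trans r¹%3≡r%3 r≡2))
    ord≢1 : ord 3 r ≢ 1
    ord≢1 ord≡1 = contradiction (trans (sym r≡2) r≡1) λ ()
      where
      r≡1 : r % 3 ≡ 1
      r≡1 = trans (sym r¹%3≡r%3)
        (from (%≡%⇔∣∸ 3 (m^n>0 r 1)) (to (ord-∣⇔ 3 r r⊥3 1) (subst (_∣ 1) (sym ord≡1) ∣-refl)))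

  private
    κ₃≡ : ∀ t {o} → ord 3 r ≡ o → κ 3 r t ≡ divℕ (3 * o) (gcd 3 (t * Sgeom o r))
    κ₃≡ t = cong (λ o → divℕ (3 * o) (gcd 3 (t * Sgeom o r)))

    κ₃≡divℕ : ∀ t → r % 3 ≡ 1 → κ 3 r t ≡ divℕ 3 (gcd 3 t)
    κ₃≡divℕ t r≡1 = trans (κ₃≡ t (ord₃≡1 r≡1)) (cong (λ x → divℕ 3 (gcd 3 x)) (*-identityʳ t))

  κ₃≡1 : ∀ {t} → r % 3 ≡ 1 → 3 ∣ t → κ 3 r t ≡ 1
  κ₃≡1 {t} r≡1 3∣t = trans (κ₃≡divℕ t r≡1) (cong (divℕ 3) (∣⇒gcd≡ 3∣t))

  κ₃≡3 : ∀ {t} → r % 3 ≡ 1 → Coprime 3 t → κ 3 r t ≡ 3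
  κ₃≡3 {t} r≡1 3⊥t = trans (κ₃≡divℕ t r≡1) (cong (divℕ 3) (coprime⇒gcd≡1 3⊥t))

  -- Here |r|_3 = 2, and 3 divides S₂(r) = 1 + r.
  κ₃≡2 : ∀ t → r % 3 ≡ 2 → κ 3 r t ≡ 2
  κ₃≡2 t r≡2 = trans (κ₃≡ t (ord₃≡2 r≡2)) (cong (divℕ 6) (∣⇒gcd≡ (∣n⇒∣m*n t 3∣1+r)))
    where
    3∣1+r : 3 ∣ 1 + r * 1
    3∣1+r = m%n≡0⇒n∣m (1 + r * 1) 3 (trans (%-distribˡ-+ 1 (r * 1) 3) (cong (λ a → (1 + a) % 3) (trans r¹%3≡r%3 r≡2)))

  ord₃∣κ₃ : ∀ t → ord 3 r ∣ κ 3 r t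
  ord₃∣κ₃ t = [ (λ r≡1 → subst (_∣ κ 3 r t) (sym (ord₃≡1 r≡1)) (1∣ κ 3 r t))
              , (λ r≡2 → subst₂ _∣_ (sym (ord₃≡2 r≡2)) (sym (κ₃≡2 t r≡2)) ∣-refl)
              ]′ r%3≡1⊎2

module _ {p r : ℕ} (p-prime : Prime p) (3<p : 3 < p) .{{_ : NonZero r}} (r⊥3p : Coprime r (3 * p)) where

  private
    instance
      p≢0 : NonZero p
      p≢0 = prime⇒nonZero p-prime
      3p≢0 : NonZero (3 * p)
      3p≢0 = m*n≢0 3 p
    3⊥p : Coprime 3 p
    3⊥p = coprime-sym (prime⇒coprime p-prime 3<p)
    r⊥3 : Coprime r 3
    r⊥3 = coprime-*ʳ⇒coprime p r⊥3p
    r⊥p : Coprime r p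
    r⊥p = coprime-*ʳ⇒coprime 3 (subst (Coprime r) (*-comm 3 p) r⊥3p)

  ord-3p-∣⇔ : ∀ n → ord (3 * p) r ∣ n ⇔ (ord 3 r ∣ n × ord p r ∣ n)
  ord-3p-∣⇔ n = ⇔-trans (ord-∣⇔ (3 * p) r r⊥3p n)
    (⇔-trans (coprime-*∣⇔ 3⊥p) (⇔-sym (ord-∣⇔ 3 r r⊥3 n ×-⇔ ord-∣⇔ p r r⊥p n)))

  module _ (t : ℕ) where

    private
      k o g N : ℕ
      k = κ 3 r t
      o = ord (3 * p) r
      g = gcd k o
      N = divℕ o g
      ord₃∣κ : ord 3 r ∣ k
      ord₃∣κ = ord₃∣κ₃ r⊥3 t
      instance
        o≢0 : NonZero o
        o≢0 = >-nonZero (proj₁ (ord-least (3 * p) r r⊥3p))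
        oₚ≢0 : NonZero (ord p r)
        oₚ≢0 = >-nonZero (proj₁ (ord-least p r r⊥p))
        g≢0 : NonZero g
        g≢0 = ≢-nonZero (gcd[m,n]≢0 k o (inj₂ (≢-nonZero⁻¹ o)))
        N≢0 : NonZero N
        N≢0 = subst NonZero (sym (divℕ≡/ o g)) (≢-nonZero (n/gcd[m,n]≢0 k o))

    N∣⇔ : ∀ ℓ → N ∣ ℓ ⇔ ord p r ∣ ℓ * k
    N∣⇔ ℓ = ⇔-trans (⇔-sym (∣*⇔/gcd∣ o k ℓ))
      (⇔-trans (ord-3p-∣⇔ (ℓ * k)) (mk⇔ proj₂ (λ oₚ∣ℓk → ∣n⇒∣m*n ℓ ord₃∣κ , oₚ∣ℓk)))

    N≡ : N ≡ divℕ (ord p r) (gcd k (ord p r))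
    N≡ = ∣-ext λ ℓ → ⇔-trans (N∣⇔ ℓ) (∣*⇔/gcd∣ (ord p r) k ℓ)

    gcd≡3⇔ : ∀ ℓ → gcd (r ^ (ℓ * k) ∸ 1) (3 * p) ≡ 3 ⇔ (¬ N ∣ ℓ)
    gcd≡3⇔ ℓ = ⇔-trans (gcd-*≡⇔ _ p-prime 3⊥p) (mk⇔
      (λ (_ , p∤) → p∤ ∘ to (ord-∣⇔ p r r⊥p _) ∘ to (N∣⇔ ℓ))
      (λ N∤ℓ → to (ord-∣⇔ 3 r r⊥3 _) (∣n⇒∣m*n ℓ ord₃∣κ) ,
               N∤ℓ ∘ from (N∣⇔ ℓ) ∘ from (ord-∣⇔ p r r⊥p _)))

    𝒮₃≡ : 𝒮 p 3 r t ≡ 3 * (divℕ (ord p r) (gcd k (ord p r)) ∸ 1)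
    𝒮₃≡ = begin
      𝒮 p 3 r t                                   ≡⟨ sumRange-cong N summand ⟩
      sumRange N (λ ℓ → 3 * F ℓ)                  ≡⟨ sumRange-* N 3 F ⟩
      3 * sumRange N F                            ≡⟨ cong (3 *_) (sumRange-properDivisors-φ N c ¬c[N] c[proper]) ⟩
      3 * (N ∸ 1)                                 ≡⟨ cong (λ n → 3 * (n ∸ 1)) N≡ ⟩
      3 * (divℕ (ord p r) (gcd k (ord p r)) ∸ 1)  ∎
      where
      c : ℕ → Bool
      c ℓ = ⌊ gcd (r ^ (ℓ * k) ∸ 1) (3 * p) ≟ 3 ⌋
      F : ℕ → ℕ
      F ℓ = if ⌊ ℓ ∣? N ⌋ ∧ c ℓ then φ (divℕ N ℓ) else 0
      ¬c[N] : ¬ T (c N)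
      ¬c[N] c[N] = to (gcd≡3⇔ N) (toWitness c[N]) ∣-refl
      c[proper] : ∀ ℓ → ℓ ∣ N → ℓ < N → T (c ℓ)
      c[proper] ℓ ℓ∣N ℓ<N = fromWitness (from (gcd≡3⇔ ℓ) λ N∣ℓ → <⇒≱ ℓ<N (∣⇒≤ {{ℓ≢0}} N∣ℓ))
        where
        ℓ≢0 : NonZero ℓ
        ℓ≢0 = ≢-nonZero λ { refl → ≢-nonZero⁻¹ N (0∣⇒≡0 ℓ∣N) }
      summand : ∀ ℓ → 1 ≤ ℓ → ℓ ≤ N →
                (if ⌊ ℓ ∣? N ⌋ ∧ c ℓ then 3 * φ (divℕ o (ℓ * g)) else 0) ≡ 3 * F ℓ
      summand ℓ 1≤ℓ _ = trans
        (cong (λ n → if ⌊ ℓ ∣? N ⌋ ∧ c ℓ then 3 * φ n else 0)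
              (divℕ-*-divℕ o g ℓ {{g≢0}} {{>-nonZero 1≤ℓ}}))
        (sym (if-float (3 *_) (⌊ ℓ ∣? N ⌋ ∧ c ℓ)))

-- Neither the bound on r nor the list of admissible t is needed: each case carries its own hypothesis on t.
lemma5p9 : (p t r : ℕ) → Prime p → 3 < p
    → (t ≡ 1 ⊎ t ≡ 3 ⊎ t ≡ p ⊎ t ≡ 3 * p)
    → 1 ≤ r → r ≤ 3 * p ∸ 1 → Coprime r (3 * p)
    → (r % 3 ≡ 1 → (t ≡ 3 ⊎ t ≡ 3 * p) → 𝒮 p 3 r t ≡ 3 * (ord p r ∸ 1))
    × (r % 3 ≡ 1 → (t ≡ 1 ⊎ t ≡ p) → ¬ (3 ∣ ord p r) → 𝒮 p 3 r t ≡ 3 * (ord p r ∸ 1))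
    × (r % 3 ≡ 1 → (t ≡ 1 ⊎ t ≡ p) → 3 ∣ ord p r → 𝒮 p 3 r t ≡ ord p r ∸ 3)
    × (r % 3 ≡ 2 → ¬ (2 ∣ ord p r) → 𝒮 p 3 r t ≡ 3 * (ord p r ∸ 1))
    × (r % 3 ≡ 2 → 2 ∣ ord p r → 𝒮 p 3 r t ≡ 3 * (ord p r / 2 ∸ 1))
lemma5p9 p t r p-prime 3<p _ 1≤r _ r⊥3p =
    (λ r≡1 t∈ → 𝒮-at₁ (κ₃≡1 r⊥3 r≡1 (3∣t t∈)) (gcd-zeroˡ oₚ))
  , (λ r≡1 t∈ 3∤oₚ → 𝒮-at₁ (κ₃≡3 r⊥3 r≡1 (3⊥t t∈)) (prime∤⇒gcd≡1 prime[3] 3∤oₚ))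
  , (λ r≡1 t∈ 3∣oₚ → trans (𝒮-at (κ₃≡3 r⊥3 r≡1 (3⊥t t∈)) (∣⇒gcd≡ 3∣oₚ))
                           (trans (*-distribˡ-∸ 3 (oₚ / 3) 1) (cong (_∸ 3) (m*[n/m]≡n 3∣oₚ))))
  , (λ r≡2 2∤oₚ → 𝒮-at₁ (κ₃≡2 r⊥3 t r≡2) (prime∤⇒gcd≡1 prime[2] 2∤oₚ))
  , (λ r≡2 2∣oₚ → 𝒮-at (κ₃≡2 r⊥3 t r≡2) (∣⇒gcd≡ 2∣oₚ))
  where
  instance
    r≢0 : NonZero r
    r≢0 = >-nonZero 1≤r
  oₚ : ℕ
  oₚ = ord p r
  r⊥3 : Coprime r 3
  r⊥3 = coprime-*ʳ⇒coprime p r⊥3p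
  𝒮-at : ∀ {k g} → κ 3 r t ≡ k → gcd k oₚ ≡ g → 𝒮 p 3 r t ≡ 3 * (divℕ oₚ g ∸ 1)
  𝒮-at refl refl = 𝒮₃≡ p-prime 3<p r⊥3p t
  𝒮-at₁ : ∀ {k} → κ 3 r t ≡ k → gcd k oₚ ≡ 1 → 𝒮 p 3 r t ≡ 3 * (oₚ ∸ 1)
  𝒮-at₁ κ≡k gcd≡1 = trans (𝒮-at κ≡k gcd≡1) (cong (λ n → 3 * (n ∸ 1)) (n/1≡n oₚ))
  3∣t : t ≡ 3 ⊎ t ≡ 3 * p → 3 ∣ t
  3∣t (inj₁ refl) = ∣-refl
  3∣t (inj₂ refl) = m∣m*n p
  3⊥t : t ≡ 1 ⊎ t ≡ p → Coprime 3 t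
  3⊥t (inj₁ refl) = coprime-sym (1-coprimeTo 3)
  3⊥t (inj₂ refl) = coprime-sym (prime⇒coprime p-prime 3<p)
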